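{- Let $Q$ be a square-free word of length $n\geq 2$. Then the number of almost-squares in $Q$, i.e. the number of pairs $(i,L)$ such that the factor of $Q$ of length $L$ beginning at position $i$ is an almost-square, is less than $$2n\log_{5/4} n.$$
   Context: A word is a finite sequence of letters. A factor of a word is a contiguous subword. A square is a nonempty word of the form $YY$; a word is square-free if none of its factors is a square. An extension of a word $W$ over an alphabet $\mathbb{A}$ is any word $W_1xW_2$ with $W=W_1W_2$ ($W_1,W_2$ possibly empty) and $x\in\mathbb{A}$. An almost-square is a word of the form $WW'$ where $W'$ is either an extension of $W$ or is obtained from $W$ by deleting one letter. -}

module Defs where

open import Data.Nat using (ℕ; _+_; _≤_)
open import Data.List using (List; []; _∷_; _++_; take; drop; length)
open import Data.Product using (Σ; ∃; _×_; _,_)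
open import Data.Sum using (_⊎_)
open import Relation.Binary.PropositionalEquality using (_≡_; _≢_)
open import Relation.Nullary using (¬_)

Word : Set → Set
Word A = List A

IsFactor : {A : Set} → Word A → Word A → Set
IsFactor {A} F Q = Σ (Word A) λ P → Σ (Word A) λ S → Q ≡ P ++ F ++ S

SquareFree : {A : Set} → Word A → Set
SquareFree {A} Q = (Y : Word A) → Y ≢ [] → ¬ IsFactor (Y ++ Y) Q

IsExtension : {A : Set} → Word A → Word A → Set
IsExtension {A} W V =
  Σ (Word A) λ W₁ → Σ (Word A) λ W₂ → Σ A λ x →
    (W ≡ W₁ ++ W₂) × (V ≡ W₁ ++ (x ∷ W₂))

IsDeletion : {A : Set} → Word A → Word A → Set
IsDeletion W V = IsExtension V W

AlmostSquare : {A : Set} → Word A → Set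
AlmostSquare {A} U = Σ (Word A) λ W → Σ (Word A) λ W' →
  (U ≡ W ++ W') × (IsExtension W W' ⊎ IsDeletion W W')

factorAt : {A : Set} → Word A → ℕ → ℕ → Word A
factorAt Q i L = take L (drop i Q)

AlmostSquareOcc : {A : Set} → Word A → ℕ × ℕ → Set
AlmostSquareOcc Q (i , L) = (i + L ≤ length Q) × AlmostSquare (factorAt Q i L)

module Submission where

-- An almost-square of half-length m starting at position i makes the first m letters of the
-- suffix of Q at i periodic with period m or m + 1 on either side of a single cut. If two
-- almost-squares at the same position have half-lengths m < M with 4m > 3M + 4, some window of
-- length M − m + 1 among those letters misses both cuts; it then carries periods p ≤ m + 1 and
-- q ≥ M with q − p at most its length, and the two periods combine into a square. So half-lengths
-- m + 2 ≤ M at one position satisfy 4m ≤ 3M + 4: at most two of them lie in ((3M + 4)/4, M],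
-- and recursing on M shows that k almost-squares at one position satisfy 5^k ≤ 4^k (n − 4)²
-- (for n ≤ 12 simply k ≤ 6). Multiplying over the n positions gives 5^c < 4^c n^(2n).

open import Defs
open import Level using (0ℓ)
open import Data.Empty using (⊥; ⊥-elim)
open import Data.Product using (∃; _×_; _,_; proj₁; proj₂)
open import Data.Sum using (_⊎_; inj₁; inj₂)
open import Data.Maybe using (Maybe)
open import Data.Maybe.Properties using (just-injective)
open import Data.Nat using (ℕ; zero; suc; _+_; _*_; _∸_; _^_; _≤_; _<_; _≤?_; _<?_; z≤n; s≤s; z<s; ⌊_/2⌋; >-nonZero)
open import Data.Nat.Properties
open import Data.Nat.DivMod using (_/_; _%_; m/n*n≤m; m≡m%n+[m/n]*n; m%n<n)
open import Data.Nat.Induction using (<-rec)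
open import Data.Nat.Tactic.RingSolver using (solve-∀)
open import Data.List using (List; []; _∷_; _++_; [_]; take; drop; length; head; filter; map)
open import Data.List.Properties using (drop-drop; take++drop≡id; ++-assoc; length-++; length-take; length-drop; length-map)
open import Data.List.Relation.Unary.All using (All; []; _∷_)
import Data.List.Relation.Unary.All as All
import Data.List.Relation.Unary.All.Properties as AllP
open import Data.List.Relation.Unary.AllPairs using (AllPairs; []; _∷_)
import Data.List.Relation.Unary.AllPairs as AP
import Data.List.Relation.Unary.AllPairs.Properties as APP
open import Data.List.Relation.Unary.Unique.Propositional using (Unique)
open import Relation.Binary.Definitions using (tri<; tri≈; tri>)
open import Relation.Binary.PropositionalEquality hiding ([_])
open import Relation.Nullary using (¬_; yes; no)
open import Relation.Unary using (Pred; Decidable)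
open import Relation.Unary.Properties using (∁?)

module _ {A : Set} where

  infixl 9 _!_

  _!_ : List A → ℕ → Maybe A
  xs ! j = head (drop j xs)

  -- Beyond the end of D both sides are nothing, so this holds vacuously there.
  Matches : List A → ℕ → ℕ → Set
  Matches D p t = D ! t ≡ D ! (t + p)

  !-drop : ∀ x (D : List A) k → drop x D ! k ≡ D ! (x + k)
  !-drop x D k = cong head (drop-drop x k D)

  !-take : ∀ L (D : List A) j → j < L → take L D ! j ≡ D ! j
  !-take (suc L) []      zero    _         = refl
  !-take (suc L) []      (suc j) _         = refl
  !-take (suc L) (a ∷ D) zero    _         = refl
  !-take (suc L) (a ∷ D) (suc j) (s≤s j<L) = !-take L D j j<L

  !-++ˡ : ∀ (xs ys : List A) j → j < length xs → (xs ++ ys) ! j ≡ xs ! j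
  !-++ˡ (x ∷ xs) ys zero    _         = refl
  !-++ˡ (x ∷ xs) ys (suc j) (s≤s j<n) = !-++ˡ xs ys j j<n

  !-++ʳ : ∀ (xs ys : List A) j → (xs ++ ys) ! (length xs + j) ≡ ys ! j
  !-++ʳ []       ys j = refl
  !-++ʳ (x ∷ xs) ys j = !-++ʳ xs ys j

  take-cong-! : ∀ d (xs ys : List A) → (∀ {k} → k < d → xs ! k ≡ ys ! k) → take d xs ≡ take d ys
  take-cong-! zero    xs       ys       _  = refl
  take-cong-! (suc d) []       []       _  = refl
  take-cong-! (suc d) []       (y ∷ ys) eq with eq z<s
  ... | ()
  take-cong-! (suc d) (x ∷ xs) []       eq with eq z<s
  ... | ()
  take-cong-! (suc d) (x ∷ xs) (y ∷ ys) eq =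
    cong₂ _∷_ (just-injective (eq z<s)) (take-cong-! d xs ys (λ k<d → eq (s≤s k<d)))

  take-≢[] : ∀ {d} (xs : List A) → 0 < d → 0 < length xs → take d xs ≢ []
  take-≢[] {suc d} (x ∷ xs) _ _ ()

  squareFree-drop : ∀ i (Q : List A) → SquareFree Q → SquareFree (drop i Q)
  squareFree-drop i Q sf Y Y≢[] (P , S , eq) = sf Y Y≢[] (take i Q ++ P , S , (begin
    Q                              ≡⟨ sym (take++drop≡id i Q) ⟩
    take i Q ++ drop i Q           ≡⟨ cong (take i Q ++_) eq ⟩
    take i Q ++ P ++ (Y ++ Y) ++ S ≡⟨ sym (++-assoc (take i Q) P _) ⟩
    (take i Q ++ P) ++ (Y ++ Y) ++ S ∎))
    where open ≡-Reasoning

  no-square-run : ∀ (D : List A) → SquareFree D → ∀ x d → 0 < d → x + (d + d) ≤ length D →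
                  (∀ {k} → k < d → Matches D d (x + k)) → ⊥
  no-square-run D sf x d 0<d fits periodic = sf Y Y≢[] (take x D , Z , D≡)
    where
    open ≡-Reasoning
    Dₓ : List A
    Dₓ = drop x D
    Y : List A
    Y = take d Dₓ
    Z : List A
    Z = drop d (drop d Dₓ)

    Y-repeats : Y ≡ take d (drop d Dₓ)
    Y-repeats = take-cong-! d Dₓ (drop d Dₓ) λ {k} k<d → begin
      Dₓ ! k            ≡⟨ !-drop x D k ⟩
      D ! (x + k)       ≡⟨ periodic k<d ⟩
      D ! (x + k + d)   ≡⟨ cong (D !_) (trans (+-assoc x k d) (cong (x +_) (+-comm k d))) ⟩
      D ! (x + (d + k)) ≡⟨ sym (!-drop x D (d + k)) ⟩
      Dₓ ! (d + k)      ≡⟨ sym (!-drop d Dₓ k) ⟩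
      drop d Dₓ ! k     ∎

    Y≢[] : Y ≢ []
    Y≢[] = take-≢[] Dₓ 0<d (subst (0 <_) (sym (length-drop x D))
             (m<n⇒0<n∸m (≤-trans (m<m+n x (≤-trans 0<d (m≤m+n d d))) fits)))

    D≡ : D ≡ take x D ++ (Y ++ Y) ++ Z
    D≡ = begin
      D                                        ≡⟨ sym (take++drop≡id x D) ⟩
      take x D ++ Dₓ                           ≡⟨ cong (take x D ++_) (sym (take++drop≡id d Dₓ)) ⟩
      take x D ++ Y ++ drop d Dₓ               ≡⟨ cong (λ z → take x D ++ Y ++ z) (sym (take++drop≡id d (drop d Dₓ))) ⟩
      take x D ++ Y ++ take d (drop d Dₓ) ++ Z ≡⟨ cong (λ z → take x D ++ Y ++ z ++ Z) (sym Y-repeats) ⟩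
      take x D ++ Y ++ Y ++ Z                  ≡⟨ cong (take x D ++_) (sym (++-assoc Y Y Z)) ⟩
      take x D ++ (Y ++ Y) ++ Z                ∎

  -- The two periods combine into period q − p on the run of that length starting at x + p.
  no-close-periods : ∀ (D : List A) → SquareFree D → ∀ x K {p q} → p < q → q ≤ p + K →
                     x + K + q ≤ length D →
                     (∀ {k} → k < K → Matches D p (x + k)) → (∀ {k} → k < K → Matches D q (x + k)) → ⊥
  no-close-periods D sf x K {p} p<q q≤p+K fits p-periodic q-periodic with m≤n⇒∃[o]m+o≡n p<q
  ... | e , refl = no-square-run D sf (x + p) d z<s run-fits run
    where
    open ≡-Reasoning
    d : ℕ
    d = suc e

    d≤K : d ≤ K
    d≤K = +-cancelˡ-≤ p d K (subst (_≤ p + K) (sym (+-suc p e)) q≤p+K)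

    run-fits : x + p + (d + d) ≤ length D
    run-fits = ≤-trans (≤-reflexive (shuffle x p e)) (≤-trans (+-monoˡ-≤ (suc p + e) (+-monoʳ-≤ x d≤K)) fits)
      where
      shuffle : ∀ x p e → x + p + (suc e + suc e) ≡ x + suc e + (suc p + e)
      shuffle = solve-∀

    run : ∀ {k} → k < d → Matches D d (x + p + k)
    run {k} k<d = begin
      D ! (x + p + k)           ≡⟨ cong (D !_) (shuffle₁ x p k) ⟩
      D ! (x + k + p)           ≡⟨ sym (p-periodic k<K) ⟩
      D ! (x + k)               ≡⟨ q-periodic k<K ⟩
      D ! (x + k + (suc p + e)) ≡⟨ cong (D !_) (shuffle₂ x p k e) ⟩
      D ! (x + p + k + d)       ∎
      where
      k<K : k < K
      k<K = <-≤-trans k<d d≤K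
      shuffle₁ : ∀ x p k → x + p + k ≡ x + k + p
      shuffle₁ = solve-∀
      shuffle₂ : ∀ x p k e → x + k + (suc p + e) ≡ x + p + k + suc e
      shuffle₂ = solve-∀

  matches-≡ : ∀ {D p t} (D′ : List A) p′ t′ → D ≡ D′ → p ≡ p′ → t ≡ t′ → Matches D p t → Matches D′ p′ t′
  matches-≡ _ _ _ refl refl refl match = match

  matches-common-prefix : ∀ (W U V : List A) t → t < length W →
                          Matches ((W ++ U) ++ (W ++ V)) (length (W ++ U)) t
  matches-common-prefix W U V t t<W = begin
    F ! t                     ≡⟨ !-++ˡ (W ++ U) (W ++ V) t t<WU ⟩
    (W ++ U) ! t              ≡⟨ !-++ˡ W U t t<W ⟩
    W ! t                     ≡⟨ sym (!-++ˡ W V t t<W) ⟩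
    (W ++ V) ! t              ≡⟨ sym (!-++ʳ (W ++ U) (W ++ V) t) ⟩
    F ! (length (W ++ U) + t) ≡⟨ cong (F !_) (+-comm (length (W ++ U)) t) ⟩
    F ! (t + length (W ++ U)) ∎
    where
    open ≡-Reasoning
    F : List A
    F = (W ++ U) ++ (W ++ V)
    t<WU : t < length (W ++ U)
    t<WU = <-≤-trans t<W (≤-trans (m≤m+n (length W) (length U)) (≤-reflexive (sym (length-++ W))))

  matches-common-suffix : ∀ (U V W : List A) s → s < length W →
                          Matches ((U ++ W) ++ (V ++ W)) (length W + length V) (length U + s)
  matches-common-suffix U V W s s<W = begin
    F ! (length U + s)                     ≡⟨ cong (_! (length U + s)) (++-assoc U W (V ++ W)) ⟩
    (U ++ W ++ V ++ W) ! (length U + s)    ≡⟨ !-++ʳ U (W ++ V ++ W) s ⟩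
    (W ++ V ++ W) ! s                      ≡⟨ !-++ˡ W (V ++ W) s s<W ⟩
    W ! s                                  ≡⟨ sym (!-++ʳ V W s) ⟩
    (V ++ W) ! (length V + s)              ≡⟨ sym (!-++ʳ (U ++ W) (V ++ W) (length V + s)) ⟩
    F ! (length (U ++ W) + (length V + s)) ≡⟨ cong (F !_) index ⟩
    F ! (length U + s + (length W + length V)) ∎
    where
    open ≡-Reasoning
    F : List A
    F = (U ++ W) ++ (V ++ W)
    shuffle : ∀ u w v s → u + w + (v + s) ≡ u + s + (w + v)
    shuffle = solve-∀
    index : length (U ++ W) + (length V + s) ≡ length U + s + (length W + length V)
    index = trans (cong (_+ (length V + s)) (length-++ U)) (shuffle (length U) (length W) (length V) s)

  -- The shape left by an almost-square of half-length m at the start of D: the letters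
  -- before and after the inserted (or deleted) letter repeat with periods m and m + 1.
  record SplitPeriodic (D : List A) (m : ℕ) : Set where
    field
      cut before after : ℕ
      before-near     : m ≤ before × before ≤ suc m
      after-near      : m ≤ after × after ≤ suc m
      periodic-before : ∀ {t} → t < m → t < cut → Matches D before t
      periodic-after  : ∀ {t} → t < m → cut < t → Matches D after t

  splitPeriodic-take : ∀ {L m} (D : List A) → L ≡ m + suc m → SplitPeriodic (take L D) m → SplitPeriodic D m
  splitPeriodic-take {m = m} D refl s = record
    { cut = cut ; before = before ; after = after
    ; before-near = before-near ; after-near = after-near
    ; periodic-before = λ t<m t<cut → untake t<m (proj₂ before-near) (periodic-before t<m t<cut)
    ; periodic-after  = λ t<m cut<t → untake t<m (proj₂ after-near) (periodic-after t<m cut<t)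
    }
    where
    open SplitPeriodic s
    untake : ∀ {t p} → t < m → p ≤ suc m → Matches (take (m + suc m) D) p t → Matches D p t
    untake {t} {p} t<m p≤1+m match =
      trans (sym (!-take _ D t (<-≤-trans t<m (m≤m+n m (suc m)))))
            (trans match (!-take _ D (t + p) (+-mono-<-≤ t<m p≤1+m)))

  extension-splitPeriodic : ∀ (W₁ W₂ : List A) x →
                            SplitPeriodic ((W₁ ++ W₂) ++ (W₁ ++ x ∷ W₂)) (length W₁ + length W₂)
  extension-splitPeriodic W₁ W₂ x = record
    { cut = a ; before = a + b ; after = suc (a + b)
    ; before-near = ≤-refl , n≤1+n (a + b) ; after-near = n≤1+n (a + b) , ≤-refl
    ; periodic-before = λ {t} _ t<a →
        matches-≡ F (a + b) t refl (length-++ W₁) refl (matches-common-prefix W₁ W₂ (x ∷ W₂) t t<a)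
    ; periodic-after = λ {t} t<m a<t →
        matches-≡ F (suc (a + b)) t (cong ((W₁ ++ W₂) ++_) (++-assoc W₁ [ x ] W₂)) period-eq (m+[n∸m]≡n (<⇒≤ a<t))
          (matches-common-suffix W₁ (W₁ ++ [ x ]) W₂ (t ∸ a)
            (+-cancelˡ-< a (t ∸ a) b (subst (_< a + b) (sym (m+[n∸m]≡n (<⇒≤ a<t))) t<m)))
    }
    where
    F : List A
    F = (W₁ ++ W₂) ++ (W₁ ++ x ∷ W₂)
    a : ℕ
    a = length W₁
    b : ℕ
    b = length W₂
    shuffle : ∀ a b → b + (a + 1) ≡ suc (a + b)
    shuffle = solve-∀
    period-eq : b + length (W₁ ++ [ x ]) ≡ suc (a + b)
    period-eq = trans (cong (b +_) (length-++ W₁)) (shuffle a b)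

  deletion-splitPeriodic : ∀ (W₁ W₂ : List A) x →
                           SplitPeriodic ((W₁ ++ x ∷ W₂) ++ (W₁ ++ W₂)) (length W₁ + length W₂)
  deletion-splitPeriodic W₁ W₂ x = record
    { cut = a ; before = suc (a + b) ; after = a + b
    ; before-near = n≤1+n (a + b) , ≤-refl ; after-near = ≤-refl , n≤1+n (a + b)
    ; periodic-before = λ {t} _ t<a →
        matches-≡ F (suc (a + b)) t refl (trans (length-++ W₁) (+-suc a b)) refl
          (matches-common-prefix W₁ (x ∷ W₂) W₂ t t<a)
    ; periodic-after = λ {t} t<m a<t →
        matches-≡ F (a + b) t (cong (_++ (W₁ ++ W₂)) (++-assoc W₁ [ x ] W₂)) (+-comm b a)
          (trans (cong (_+ (t ∸ suc a)) (trans (length-++ W₁) (+-comm a 1))) (m+[n∸m]≡n a<t))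
          (matches-common-suffix (W₁ ++ [ x ]) W₁ W₂ (t ∸ suc a) (after-cut t<m a<t))
    }
    where
    F : List A
    F = (W₁ ++ x ∷ W₂) ++ (W₁ ++ W₂)
    a : ℕ
    a = length W₁
    b : ℕ
    b = length W₂
    after-cut : ∀ {t} → t < a + b → a < t → t ∸ suc a < b
    after-cut {t} t<m a<t = +-cancelˡ-< a (t ∸ suc a) b (<-trans (+-monoʳ-< a (n<1+n (t ∸ suc a)))
      (subst (_< a + b) (trans (sym (m+[n∸m]≡n a<t)) (sym (+-suc a (t ∸ suc a)))) t<m))

  length-halves : ∀ (U₁ U₂ V₁ V₂ : List A) →
                  length ((U₁ ++ U₂) ++ (V₁ ++ V₂)) ≡ (length U₁ + length U₂) + (length V₁ + length V₂)
  length-halves U₁ U₂ V₁ V₂ = trans (length-++ (U₁ ++ U₂)) (cong₂ _+_ (length-++ U₁) (length-++ V₁))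

  almostSquare-splitPeriodic : ∀ (F : List A) → AlmostSquare F →
                               ∃ λ m → length F ≡ m + suc m × SplitPeriodic F m
  almostSquare-splitPeriodic _ (_ , _ , refl , inj₁ (W₁ , W₂ , x , refl , refl)) =
    length W₁ + length W₂ ,
    trans (length-halves W₁ W₂ W₁ (x ∷ W₂)) (shuffle (length W₁) (length W₂)) ,
    extension-splitPeriodic W₁ W₂ x
    where
    shuffle : ∀ a b → a + b + (a + suc b) ≡ a + b + suc (a + b)
    shuffle = solve-∀
  almostSquare-splitPeriodic _ (_ , _ , refl , inj₂ (W₁ , W₂ , x , refl , refl)) =
    length W₁ + length W₂ ,
    trans (length-halves W₁ (x ∷ W₂) W₁ W₂) (shuffle (length W₁) (length W₂)) ,
    deletion-splitPeriodic W₁ W₂ x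
    where
    shuffle : ∀ a b → a + suc b + (a + b) ≡ a + b + suc (a + b)
    shuffle = solve-∀

  factor-fits : ∀ (Q : List A) {i L} → i + L ≤ length Q → L ≤ length (drop i Q)
  factor-fits Q {i} {L} fits =
    subst (L ≤_) (sym (length-drop i Q)) (m+n≤o⇒m≤o∸n L (subst (_≤ length Q) (+-comm i L) fits))

  factor-length : ∀ (Q : List A) {i L} → i + L ≤ length Q → length (factorAt Q i L) ≡ L
  factor-length Q {i} {L} fits = trans (length-take L (drop i Q)) (m≤n⇒m⊓n≡m (factor-fits Q fits))

  occurrence-splitPeriodic : ∀ (Q : List A) {i L} → AlmostSquareOcc Q (i , L) →
                             L ≡ ⌊ L /2⌋ + suc ⌊ L /2⌋ × SplitPeriodic (drop i Q) ⌊ L /2⌋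
  occurrence-splitPeriodic Q {i} {L} (fits , square) with almostSquare-splitPeriodic _ square
  ... | m , length≡ , split =
    subst (λ h → L ≡ h + suc h × SplitPeriodic (drop i Q) h) (sym ⌊L/2⌋≡m)
          (L≡ , splitPeriodic-take (drop i Q) L≡ split)
    where
    L≡ : L ≡ m + suc m
    L≡ = trans (sym (factor-length Q fits)) length≡
    ⌊L/2⌋≡m : ⌊ L /2⌋ ≡ m
    ⌊L/2⌋≡m = trans (cong ⌊_/2⌋ (trans L≡ (+-suc m m))) (sym (n≡⌈n+n/2⌉ m))

Avoids : ℕ → ℕ → ℕ → Set
Avoids K x c = x + K ≤ c ⊎ c < x

-- One of the windows starting at 0, just after c, or just after c′ fits.
window-avoiding-≤ : ∀ K m {c c′} → c ≤ c′ → K + K + K ≤ m →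
                    ∃ λ x → x + K ≤ m × Avoids K x c × Avoids K x c′
window-avoiding-≤ K m {c} {c′} c≤c′ 3K≤m with K ≤? c | suc c + K ≤? c′
... | yes K≤c | _        = 0 , ≤-trans (m≤m+n K K) (≤-trans (m≤m+n (K + K) K) 3K≤m) , inj₁ K≤c , inj₁ (≤-trans K≤c c≤c′)
... | no K≰c  | yes room = suc c , ≤-trans (+-monoˡ-≤ K (≰⇒> K≰c)) (≤-trans (m≤m+n (K + K) K) 3K≤m) ,
                           inj₂ (n<1+n c) , inj₁ room
... | no K≰c  | no ¬room = suc c′ , ≤-trans (+-monoˡ-≤ K (≤-trans (≰⇒> ¬room) (+-monoˡ-≤ K (≰⇒> K≰c)))) 3K≤m ,
                           inj₂ (s≤s c≤c′) , inj₂ (n<1+n c′)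

window-avoiding : ∀ K m c c′ → K + K + K ≤ m → ∃ λ x → x + K ≤ m × Avoids K x c × Avoids K x c′
window-avoiding K m c c′ 3K≤m with ≤-total c c′
... | inj₁ c≤c′ = window-avoiding-≤ K m c≤c′ 3K≤m
... | inj₂ c′≤c with window-avoiding-≤ K m c′≤c 3K≤m
...   | x , fits , avoids-c′ , avoids-c = x , fits , avoids-c , avoids-c′

Gapped : ℕ → ℕ → Set
Gapped a b = a + 2 ≤ b → 4 * a ≤ 3 * b + 4

¬gapped⇒room : ∀ m e → ¬ (4 * m ≤ 3 * (m + e) + 4) → suc e + suc e + suc e ≤ m
¬gapped⇒room m e ¬gapped =
  m+n≤o⇒m≤o (suc e + suc e + suc e) (+-cancelʳ-≤ (3 * m) _ _ (subst₂ _≤_ (shuffle₁ m e) (shuffle₂ m) (≰⇒> ¬gapped)))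
  where
  shuffle₁ : ∀ m e → suc (3 * (m + e) + 4) ≡ suc e + suc e + suc e + 2 + 3 * m
  shuffle₁ = solve-∀
  shuffle₂ : ∀ m → 4 * m ≡ m + 3 * m
  shuffle₂ = solve-∀

module _ {A : Set} where

  window-period : ∀ {D : List A} {m} (s : SplitPeriodic D m) {x K} → x + K ≤ m →
                  Avoids K x (SplitPeriodic.cut s) →
                  ∃ λ p → (m ≤ p × p ≤ suc m) × (∀ {k} → k < K → Matches D p (x + k))
  window-period s {x} fits (inj₁ before-cut) =
    before , before-near , λ k<K → periodic-before (<-≤-trans (+-monoʳ-< x k<K) fits)
                                                   (<-≤-trans (+-monoʳ-< x k<K) before-cut)
    where open SplitPeriodic s
  window-period s {x} fits (inj₂ cut<x) =
    after , after-near , λ {k} k<K → periodic-after (<-≤-trans (+-monoʳ-< x k<K) fits)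
                                                    (<-≤-trans cut<x (m≤m+n x k))
    where open SplitPeriodic s

  splitPeriodic-gapped : ∀ (D : List A) → SquareFree D → ∀ {m M} → SplitPeriodic D m → SplitPeriodic D M →
                         M + suc M ≤ length D → Gapped m M
  splitPeriodic-gapped D sf {m} {M} s S fits m+2≤M with 4 * m ≤? 3 * M + 4 | m≤n⇒∃[o]m+o≡n (m+n≤o⇒m≤o m m+2≤M)
  ... | yes gapped   | _        = gapped
  ... | no ¬gapped   | e , refl with window-avoiding (suc e) m (SplitPeriodic.cut s) (SplitPeriodic.cut S) (¬gapped⇒room m e ¬gapped)
  ...   | x , x+K≤m , avoids-s , avoids-S with window-period s x+K≤m avoids-s
                                             | window-period S (≤-trans x+K≤m (m≤m+n m e)) avoids-S
  ...     | p , (m≤p , p≤1+m) , p-periodic | q , (M≤q , q≤1+M) , q-periodic =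
    ⊥-elim (no-close-periods D sf x K p<q q≤p+K window-fits p-periodic q-periodic)
    where
    K : ℕ
    K = suc e

    p<q : p < q
    p<q = <-≤-trans (s≤s p≤1+m) (≤-trans (≤-reflexive (+-comm 2 m)) (≤-trans m+2≤M M≤q))

    q≤p+K : q ≤ p + K
    q≤p+K = ≤-trans q≤1+M (≤-trans (≤-reflexive (sym (+-suc m e))) (+-monoˡ-≤ K m≤p))

    window-fits : x + K + q ≤ length D
    window-fits = ≤-trans (+-mono-≤ (≤-trans x+K≤m (m≤m+n m e)) q≤1+M) fits

  occurrences-gapped : ∀ (Q : List A) → SquareFree Q → ∀ {i L L′} →
                       AlmostSquareOcc Q (i , L) → AlmostSquareOcc Q (i , L′) → Gapped ⌊ L /2⌋ ⌊ L′ /2⌋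
  occurrences-gapped Q sf {i} o o′ with occurrence-splitPeriodic Q o | occurrence-splitPeriodic Q o′
  ... | _ , split | L′≡ , split′ =
    splitPeriodic-gapped (drop i Q) (squareFree-drop i Q sf) split split′
      (subst (_≤ length (drop i Q)) L′≡ (factor-fits Q (proj₁ o′)))

Spread : ℕ → ℕ → Set
Spread a b = a ≢ b × Gapped a b × Gapped b a

module _ {A : Set} where

  occurrences-spread : ∀ (Q : List A) → SquareFree Q → ∀ {i L L′} →
                       AlmostSquareOcc Q (i , L) → AlmostSquareOcc Q (i , L′) → (i , L) ≢ (i , L′) →
                       Spread ⌊ L /2⌋ ⌊ L′ /2⌋
  occurrences-spread Q sf {i} {L} {L′} o o′ distinct =
    (λ halves≡ → distinct (cong (i ,_) (trans L≡ (trans (cong (λ h → h + suc h) halves≡) (sym L′≡))))) ,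
    occurrences-gapped Q sf o o′ , occurrences-gapped Q sf o′ o
    where
    L≡ : L ≡ ⌊ L /2⌋ + suc ⌊ L /2⌋
    L≡ = proj₁ (occurrence-splitPeriodic Q o)
    L′≡ : L′ ≡ ⌊ L′ /2⌋ + suc ⌊ L′ /2⌋
    L′≡ = proj₁ (occurrence-splitPeriodic Q o′)

length-filter-∁ : ∀ {X : Set} {P : Pred X 0ℓ} (P? : Decidable P) xs →
                  length xs ≡ length (filter P? xs) + length (filter (∁? P?) xs)
length-filter-∁ P? []       = refl
length-filter-∁ P? (x ∷ xs) with P? x
... | yes _ = cong suc (length-filter-∁ P? xs)
... | no  _ = trans (cong suc (length-filter-∁ P? xs)) (sym (+-suc _ _))

distinct-constant : ∀ {c} (ns : List ℕ) → AllPairs _≢_ ns → All (_≡ c) ns → length ns ≤ 1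
distinct-constant []          _                 _                 = z≤n
distinct-constant (_ ∷ [])    _                 _                 = s≤s z≤n
distinct-constant (_ ∷ _ ∷ _) ((x≢y ∷ _) ∷ _) (x≡c ∷ y≡c ∷ _) = ⊥-elim (x≢y (trans x≡c (sym y≡c)))

distinct-below : ∀ B (ns : List ℕ) → AllPairs _≢_ ns → All (_< B) ns → length ns ≤ B
distinct-below zero    []       _        _        = z≤n
distinct-below zero    (_ ∷ _)  _        (() ∷ _)
distinct-below (suc B) ns       distinct below = begin
  length ns                                                    ≡⟨ length-filter-∁ (_<? B) ns ⟩
  length (filter (_<? B) ns) + length (filter (∁? (_<? B)) ns) ≤⟨ +-mono-≤ below-B equal-B ⟩
  B + 1                                                        ≡⟨ +-comm B 1 ⟩
  suc B                                                        ∎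
  where
  open ≤-Reasoning
  below-B : length (filter (_<? B) ns) ≤ B
  below-B = distinct-below B _ (APP.filter⁺ (_<? B) distinct) (AllP.all-filter (_<? B) ns)
  equal-B : length (filter (∁? (_<? B)) ns) ≤ 1
  equal-B = distinct-constant _ (APP.filter⁺ (∁? (_<? B)) distinct)
    (All.zipWith (λ (n<1+B , n≮B) → ≤-antisym (≤-pred n<1+B) (≮⇒≥ n≮B))
                 (AllP.filter⁺ (∁? (_<? B)) below , AllP.all-filter (∁? (_<? B)) ns))

Close : ℕ → ℕ → Set
Close a b = ¬ (a + 2 ≤ b) × ¬ (b + 2 ≤ a)

<-<⇒+2≤ : ∀ {a b c} → a < b → b < c → a + 2 ≤ c
<-<⇒+2≤ {a} {b} {c} a<b b<c = subst (_≤ c) (+-comm 2 a) (≤-trans (s≤s a<b) b<c)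

no-three-close : ∀ {a b c} → a ≢ b → a ≢ c → b ≢ c → Close a b → Close a c → Close b c → ⊥
no-three-close {a} {b} {c} a≢b a≢c b≢c ab ac bc with <-cmp a b
... | tri≈ _ a≡b _ = a≢b a≡b
... | tri< a<b _ _ with <-cmp b c
...   | tri< b<c _ _ = proj₁ ac (<-<⇒+2≤ a<b b<c)
...   | tri≈ _ b≡c _ = b≢c b≡c
...   | tri> _ _ c<b with <-cmp a c
...     | tri< a<c _ _ = proj₁ ab (<-<⇒+2≤ a<c c<b)
...     | tri≈ _ a≡c _ = a≢c a≡c
...     | tri> _ _ c<a = proj₂ bc (<-<⇒+2≤ c<a a<b)
no-three-close {a} {b} {c} a≢b a≢c b≢c ab ac bc | tri> _ _ b<a with <-cmp a c
...   | tri< a<c _ _ = proj₁ bc (<-<⇒+2≤ b<a a<c)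
...   | tri≈ _ a≡c _ = a≢c a≡c
...   | tri> _ _ c<a with <-cmp b c
...     | tri< b<c _ _ = proj₂ ab (<-<⇒+2≤ b<c c<a)
...     | tri≈ _ b≡c _ = b≢c b≡c
...     | tri> _ _ c<b = proj₂ ac (<-<⇒+2≤ c<b b<a)

gapped-window-close : ∀ {R M a b} → 3 * M + 4 < 4 * R + 4 → R < a → b ≤ M → Gapped a b → ¬ (a + 2 ≤ b)
gapped-window-close {R} {M} {a} {b} window R<a b≤M gapped a+2≤b = n≮n (4 * a) (begin-strict
  4 * a     ≤⟨ gapped a+2≤b ⟩
  3 * b + 4 ≤⟨ +-monoˡ-≤ 4 (*-monoʳ-≤ 3 b≤M) ⟩
  3 * M + 4 <⟨ window ⟩
  4 * R + 4 ≡⟨ +-comm (4 * R) 4 ⟩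
  4 + 4 * R ≡⟨ sym (*-suc 4 R) ⟩
  4 * suc R ≤⟨ *-monoʳ-≤ 4 R<a ⟩
  4 * a     ∎)
  where open ≤-Reasoning

window-length≤2 : ∀ {R M} → 3 * M + 4 < 4 * R + 4 → ∀ ns → AllPairs Spread ns →
                  All (λ n → R < n × n ≤ M) ns → length ns ≤ 2
window-length≤2 _      []          _ _ = z≤n
window-length≤2 _      (_ ∷ [])    _ _ = s≤s z≤n
window-length≤2 _      (_ ∷ _ ∷ []) _ _ = s≤s (s≤s z≤n)
window-length≤2 {R} {M} window (_ ∷ _ ∷ _ ∷ _) ((ab ∷ ac ∷ _) ∷ (bc ∷ _) ∷ _) (a∈ ∷ b∈ ∷ c∈ ∷ _) =
  ⊥-elim (no-three-close (proj₁ ab) (proj₁ ac) (proj₁ bc) (close ab a∈ b∈) (close ac a∈ c∈) (close bc b∈ c∈))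
  where
  close : ∀ {x y} → Spread x y → R < x × x ≤ M → R < y × y ≤ M → Close x y
  close (_ , gapped-xy , gapped-yx) (R<x , x≤M) (R<y , y≤M) =
    gapped-window-close window R<x y≤M gapped-xy , gapped-window-close window R<y x≤M gapped-yx

5^k*4^j≤4^k*5^j : ∀ {k j} → k ≤ j → 5 ^ k * 4 ^ j ≤ 4 ^ k * 5 ^ j
5^k*4^j≤4^k*5^j {zero} {j} _ =
  subst₂ _≤_ (sym (*-identityˡ (4 ^ j))) (sym (*-identityˡ (5 ^ j))) (^-monoˡ-≤ j (n≤1+n 4))
5^k*4^j≤4^k*5^j {suc k} {suc j} (s≤s k≤j) =
  subst₂ _≤_ (shuffle 5 4 (5 ^ k) (4 ^ j)) (shuffle 4 5 (4 ^ k) (5 ^ j)) (*-monoʳ-≤ 20 (5^k*4^j≤4^k*5^j k≤j))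
  where
  shuffle : ∀ u v a b → u * v * (a * b) ≡ u * a * (v * b)
  shuffle = solve-∀

5^k≤4^k*81 : ∀ {k} → k ≤ 16 → 5 ^ k ≤ 4 ^ k * 81
5^k≤4^k*81 {k} k≤16 = *-cancelʳ-≤ (5 ^ k) (4 ^ k * 81) (4 ^ 16) {{m^n≢0 4 16}} (begin
  5 ^ k * 4 ^ 16        ≤⟨ 5^k*4^j≤4^k*5^j k≤16 ⟩
  4 ^ k * 5 ^ 16        ≤⟨ *-monoʳ-≤ (4 ^ k) (≤ᵇ⇒≤ (5 ^ 16) (81 * 4 ^ 16) _) ⟩
  4 ^ k * (81 * 4 ^ 16) ≡⟨ sym (*-assoc (4 ^ k) 81 (4 ^ 16)) ⟩
  4 ^ k * 81 * 4 ^ 16   ∎)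
  where open ≤-Reasoning

16*5^b≤25*4^b : ∀ {b} → b ≤ 2 → 16 * 5 ^ b ≤ 25 * 4 ^ b
16*5^b≤25*4^b {0} _ = ≤ᵇ⇒≤ _ _ _
16*5^b≤25*4^b {1} _ = ≤ᵇ⇒≤ _ _ _
16*5^b≤25*4^b {2} _ = ≤ᵇ⇒≤ _ _ _
16*5^b≤25*4^b {suc (suc (suc _))} (s≤s (s≤s ()))

5[R∸4]≤4[M∸4] : ∀ {R M} → 4 * R ≤ 3 * M + 4 → 4 ≤ R → 4 ≤ M → 5 * (R ∸ 4) ≤ 4 * (M ∸ 4)
5[R∸4]≤4[M∸4] 4R≤3M+4 4≤R 4≤M with m≤n⇒∃[o]m+o≡n 4≤R | m≤n⇒∃[o]m+o≡n 4≤M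
... | r , refl | s , refl rewrite m+n∸m≡n 4 r | m+n∸m≡n 4 s = begin
  5 * r     ≡⟨ shuffle₀ r ⟩
  4 * r + r ≤⟨ +-mono-≤ 4r≤3s (*-cancelˡ-≤ 4 (≤-trans 4r≤3s (*-monoˡ-≤ s (n≤1+n 3)))) ⟩
  3 * s + s ≡⟨ +-comm (3 * s) s ⟩
  4 * s     ∎
  where
  open ≤-Reasoning
  shuffle₀ : ∀ r → 5 * r ≡ 4 * r + r
  shuffle₀ = solve-∀
  shuffle₁ : ∀ r → 4 * (4 + r) ≡ 4 * r + 16
  shuffle₁ = solve-∀
  shuffle₂ : ∀ s → 3 * (4 + s) + 4 ≡ 3 * s + 16
  shuffle₂ = solve-∀
  4r≤3s : 4 * r ≤ 3 * s
  4r≤3s = +-cancelʳ-≤ 16 _ _ (subst₂ _≤_ (shuffle₁ r) (shuffle₂ s) 4R≤3M+4)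

combine-bounds : ∀ u v w z r s → u ≤ w * (r * r) → 16 * v ≤ 25 * z → 5 * r ≤ 4 * s →
                 u * v ≤ (w * z) * (s * s)
combine-bounds u v w z r s u≤ 16v≤ 5r≤ = *-cancelˡ-≤ 16 (begin
  16 * (u * v)                  ≡⟨ shuffle₁ u v ⟩
  u * (16 * v)                  ≤⟨ *-mono-≤ u≤ 16v≤ ⟩
  (w * (r * r)) * (25 * z)      ≡⟨ shuffle₂ w r z ⟩
  (w * z) * ((5 * r) * (5 * r)) ≤⟨ *-monoʳ-≤ (w * z) (*-mono-≤ 5r≤ 5r≤) ⟩
  (w * z) * ((4 * s) * (4 * s)) ≡⟨ shuffle₃ w z s ⟩
  16 * ((w * z) * (s * s))      ∎)
  where
  open ≤-Reasoning
  shuffle₁ : ∀ u v → 16 * (u * v) ≡ u * (16 * v)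
  shuffle₁ = solve-∀
  shuffle₂ : ∀ w r z → (w * (r * r)) * (25 * z) ≡ (w * z) * ((5 * r) * (5 * r))
  shuffle₂ = solve-∀
  shuffle₃ : ∀ w z s → (w * z) * ((4 * s) * (4 * s)) ≡ 16 * ((w * z) * (s * s))
  shuffle₃ = solve-∀

quarter-bounds : ∀ N → 4 * (N / 4) ≤ N × N < 4 * (N / 4) + 4
quarter-bounds N = subst (_≤ N) (*-comm (N / 4) 4) (m/n*n≤m N 4) ,
  (begin-strict
    N                 ≡⟨ m≡m%n+[m/n]*n N 4 ⟩
    N % 4 + N / 4 * 4 <⟨ +-monoˡ-< (N / 4 * 4) (m%n<n N 4) ⟩
    4 + N / 4 * 4     ≡⟨ cong₂ _+_ refl (*-comm (N / 4) 4) ⟩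
    4 + 4 * (N / 4)   ≡⟨ +-comm 4 (4 * (N / 4)) ⟩
    4 * (N / 4) + 4   ∎)
  where open ≤-Reasoning

SpreadBound : ℕ → Set
SpreadBound M = ∀ ns → AllPairs Spread ns → All (_≤ M) ns →
                5 ^ length ns ≤ 4 ^ length ns * ((M ∸ 4) * (M ∸ 4))

spread-bound-small : ∀ {M} → 13 ≤ M → M ≤ 15 → SpreadBound M
spread-bound-small {M} 13≤M M≤15 ns spread below = ≤-trans
  (5^k≤4^k*81 (≤-trans (distinct-below (suc M) ns (AP.map proj₁ spread) (All.map s≤s below)) (s≤s M≤15)))
  (*-monoʳ-≤ (4 ^ length ns) (*-mono-≤ 9≤M∸4 9≤M∸4))
  where
  9≤M∸4 : 9 ≤ M ∸ 4
  9≤M∸4 = ∸-monoˡ-≤ 4 13≤M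

-- At most two half-lengths lie above R; their factor (5/4)² is paid for by
-- (M − 4)² ≥ (5/4)² (R − 4)².
spread-bound-step : ∀ {R M} → 4 * R ≤ 3 * M + 4 → 3 * M + 4 < 4 * R + 4 → 4 ≤ R → 4 ≤ M →
                    SpreadBound R → SpreadBound M
spread-bound-step {R} {M} 4R≤ <4R+4 4≤R 4≤M bound-R ns spread below = begin
  5 ^ length ns         ≡⟨ cong (5 ^_) (length-filter-∁ (_≤? R) ns) ⟩
  5 ^ (a + b)           ≡⟨ ^-distribˡ-+-* 5 a b ⟩
  5 ^ a * 5 ^ b         ≤⟨ combine-bounds (5 ^ a) (5 ^ b) (4 ^ a) (4 ^ b) (R ∸ 4) (M ∸ 4)
                             low-bound (16*5^b≤25*4^b high-count) (5[R∸4]≤4[M∸4] 4R≤ 4≤R 4≤M) ⟩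
  4 ^ a * 4 ^ b * S     ≡⟨ cong (_* S) (sym (^-distribˡ-+-* 4 a b)) ⟩
  4 ^ (a + b) * S       ≡⟨ cong (λ k → 4 ^ k * S) (sym (length-filter-∁ (_≤? R) ns)) ⟩
  4 ^ length ns * S     ∎
  where
  open ≤-Reasoning
  low : List ℕ
  low = filter (_≤? R) ns
  high : List ℕ
  high = filter (∁? (_≤? R)) ns
  a : ℕ
  a = length low
  b : ℕ
  b = length high
  S : ℕ
  S = (M ∸ 4) * (M ∸ 4)
  low-bound : 5 ^ a ≤ 4 ^ a * ((R ∸ 4) * (R ∸ 4))
  low-bound = bound-R low (APP.filter⁺ (_≤? R) spread) (AllP.all-filter (_≤? R) ns)
  high-count : b ≤ 2
  high-count = window-length≤2 <4R+4 high (APP.filter⁺ (∁? (_≤? R)) spread)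
    (All.zipWith (λ (n≰R , n≤M) → ≰⇒> n≰R , n≤M)
                 (AllP.all-filter (∁? (_≤? R)) ns , AllP.filter⁺ (∁? (_≤? R)) below))

spread-bound : ∀ M → 13 ≤ M → SpreadBound M
spread-bound = <-rec (λ M → 13 ≤ M → SpreadBound M) bound
  where
  bound : ∀ M → (∀ {R} → R < M → 13 ≤ R → SpreadBound R) → 13 ≤ M → SpreadBound M
  bound M rec 13≤M with M ≤? 15
  ... | yes M≤15 = spread-bound-small 13≤M M≤15
  ... | no  M≰15 = spread-bound-step 4R≤ <4R+4 (≤-trans 4≤13 13≤R) (≤-trans 4≤13 13≤M) (rec R<M 13≤R)
    where
    R : ℕ
    R = (3 * M + 4) / 4
    4R≤ : 4 * R ≤ 3 * M + 4
    4R≤ = proj₁ (quarter-bounds (3 * M + 4))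
    <4R+4 : 3 * M + 4 < 4 * R + 4
    <4R+4 = proj₂ (quarter-bounds (3 * M + 4))
    4≤13 : 4 ≤ 13
    4≤13 = ≤ᵇ⇒≤ 4 13 _
    R<M : R < M
    R<M = *-cancelˡ-< 4 R M (≤-<-trans 4R≤ (subst (3 * M + 4 <_) (+-comm (3 * M) M) (+-monoʳ-< (3 * M) 4<M)))
      where 4<M : 4 < M
            4<M = ≤-trans (≤ᵇ⇒≤ 5 16 _) (≰⇒> M≰15)
    13≤R : 13 ≤ R
    13≤R = *-cancelˡ-< 4 12 R (+-cancelʳ-< 4 (4 * 12) (4 * R) (≤-<-trans 52≤3M+4 <4R+4))
      where 52≤3M+4 : 52 ≤ 3 * M + 4
            52≤3M+4 = +-monoˡ-≤ 4 (*-monoʳ-≤ 3 (≰⇒> M≰15))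

m+[1+m]≤12⇒m<6 : ∀ {m} → m + suc m ≤ 12 → m < 6
m+[1+m]≤12⇒m<6 {m} fits with m <? 6
... | yes m<6 = m<6
... | no  m≮6 = ⊥-elim (n≮n 12 (≤-trans (+-mono-≤ (≮⇒≥ m≮6) (s≤s (≮⇒≥ m≮6))) fits))

allPairs-mapWithAll : ∀ {X : Set} {P : X → Set} {R S : X → X → Set} →
                      (∀ {x y} → P x → P y → R x y → S x y) → ∀ {xs} → All P xs → AllPairs R xs → AllPairs S xs
allPairs-mapWithAll f []         []         = []
allPairs-mapWithAll f (px ∷ pxs) (rs ∷ rss) =
  All.zipWith (λ (py , r) → f px py r) (pxs , rs) ∷ allPairs-mapWithAll f pxs rss

half : ℕ × ℕ → ℕ
half (_ , L) = ⌊ L /2⌋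

module _ {A : Set} (Q : List A) where

  OccursAt : ℕ → ℕ × ℕ → Set
  OccursAt i o = AlmostSquareOcc Q o × proj₁ o ≡ i

  occurrence-half : ∀ {i L} → AlmostSquareOcc Q (i , L) → ⌊ L /2⌋ + suc ⌊ L /2⌋ ≤ length Q
  occurrence-half {i} {L} occ =
    subst (_≤ length Q) (proj₁ (occurrence-splitPeriodic Q occ)) (m+n≤o⇒n≤o i (proj₁ occ))

  occurrence-position : ∀ {o} → AlmostSquareOcc Q o → proj₁ o < length Q
  occurrence-position {i , L} occ =
    <-≤-trans (m<m+n i (subst (0 <_) (sym (proj₁ (occurrence-splitPeriodic Q occ))) (≤-trans z<s (m≤n+m _ ⌊ L /2⌋))))
              (proj₁ occ)

module _ {A : Set} (Q : List A) (sf : SquareFree Q) where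

  halves-spread : ∀ {i} ys → Unique ys → All (OccursAt Q i) ys → AllPairs Spread (map half ys)
  halves-spread ys distinct occ = APP.map⁺ (allPairs-mapWithAll spread occ distinct)
    where
    spread : ∀ {o o′} → OccursAt Q _ o → OccursAt Q _ o′ → o ≢ o′ → Spread (half o) (half o′)
    spread {_ , _} {_ , _} (occ , refl) (occ′ , refl) = occurrences-spread Q sf occ occ′

  position-bound-small : length Q ≤ 12 → ∀ i ys → Unique ys → All (OccursAt Q i) ys →
                         5 ^ length ys * 4 ^ 6 ≤ 4 ^ length ys * 5 ^ 6
  position-bound-small n≤12 i ys distinct occ = 5^k*4^j≤4^k*5^j (subst (_≤ 6) (length-map half ys)
    (distinct-below 6 (map half ys) (AP.map proj₁ (halves-spread ys distinct occ))
      (AllP.map⁺ (All.map (λ (o , _) → m+[1+m]≤12⇒m<6 (≤-trans (occurrence-half Q o) n≤12)) occ))))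

  position-bound-large : 13 ≤ length Q → ∀ i ys → Unique ys → All (OccursAt Q i) ys →
                         5 ^ length ys * 1 ≤ 4 ^ length ys * ((length Q ∸ 4) * (length Q ∸ 4))
  position-bound-large 13≤n i ys distinct occ = begin
    5 ^ length ys * 1          ≡⟨ *-identityʳ _ ⟩
    5 ^ length ys              ≡⟨ cong (5 ^_) (sym (length-map half ys)) ⟩
    5 ^ length (map half ys)   ≤⟨ spread-bound (length Q) 13≤n (map half ys) (halves-spread ys distinct occ)
                                    (AllP.map⁺ (All.map (λ (o , _) → m+n≤o⇒m≤o _ (occurrence-half Q o)) occ)) ⟩
    4 ^ length (map half ys) * S ≡⟨ cong (λ k → 4 ^ k * S) (length-map half ys) ⟩
    4 ^ length ys * S          ∎
    where
    open ≤-Reasoning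
    S : ℕ
    S = (length Q ∸ 4) * (length Q ∸ 4)

*-mono-≤-interchange : ∀ u v w z t₁ t₂ b₁ b₂ → u * t₁ ≤ w * b₁ → v * t₂ ≤ z * b₂ →
                       (u * v) * (t₂ * t₁) ≤ (w * z) * (b₂ * b₁)
*-mono-≤-interchange u v w z t₁ t₂ b₁ b₂ ≤₁ ≤₂ =
  subst₂ _≤_ (shuffle u v t₁ t₂) (shuffle w z b₁ b₂) (*-mono-≤ ≤₁ ≤₂)
  where
  shuffle : ∀ u v t₁ t₂ → (u * t₁) * (v * t₂) ≡ (u * v) * (t₂ * t₁)
  shuffle = solve-∀

module _ {P : ℕ × ℕ → Set} {T B : ℕ}
  (position-bound : ∀ i ys → Unique ys → All (λ o → P o × proj₁ o ≡ i) ys →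
                    5 ^ length ys * T ≤ 4 ^ length ys * B) where

  positions-bound : ∀ j ps → Unique ps → All P ps → All (λ o → proj₁ o < j) ps →
                    5 ^ length ps * T ^ j ≤ 4 ^ length ps * B ^ j
  positions-bound zero    []      _        _ _        = ≤-refl
  positions-bound zero    (_ ∷ _) _        _ (() ∷ _)
  positions-bound (suc j) ps      distinct p below = begin
    5 ^ length ps * (T * T ^ j)       ≡⟨ cong (λ k → 5 ^ k * (T * T ^ j)) (length-filter-∁ (before? j) ps) ⟩
    5 ^ (a + b) * (T * T ^ j)         ≡⟨ cong (_* (T * T ^ j)) (^-distribˡ-+-* 5 a b) ⟩
    5 ^ a * 5 ^ b * (T * T ^ j)       ≤⟨ *-mono-≤-interchange (5 ^ a) (5 ^ b) (4 ^ a) (4 ^ b) (T ^ j) T (B ^ j) B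
                                           earlier last ⟩
    4 ^ a * 4 ^ b * (B * B ^ j)       ≡⟨ cong (_* (B * B ^ j)) (sym (^-distribˡ-+-* 4 a b)) ⟩
    4 ^ (a + b) * (B * B ^ j)         ≡⟨ cong (λ k → 4 ^ k * (B * B ^ j)) (sym (length-filter-∁ (before? j) ps)) ⟩
    4 ^ length ps * (B * B ^ j)       ∎
    where
    open ≤-Reasoning
    before? : ∀ j → Decidable (λ (o : ℕ × ℕ) → proj₁ o < j)
    before? j o = proj₁ o <? j
    a : ℕ
    a = length (filter (before? j) ps)
    b : ℕ
    b = length (filter (∁? (before? j)) ps)
    earlier : 5 ^ a * T ^ j ≤ 4 ^ a * B ^ j
    earlier = positions-bound j _ (APP.filter⁺ (before? j) distinct) (AllP.filter⁺ (before? j) p)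
                                  (AllP.all-filter (before? j) ps)
    last : 5 ^ b * T ≤ 4 ^ b * B
    last = position-bound j _ (APP.filter⁺ (∁? (before? j)) distinct)
      (All.zipWith (λ (po , (o<1+j , o≮j)) → po , ≤-antisym (≤-pred o<1+j) (≮⇒≥ o≮j))
        (AllP.filter⁺ (∁? (before? j)) p ,
         All.zip (AllP.filter⁺ (∁? (before? j)) below , AllP.all-filter (∁? (before? j)) ps)))

^-distribʳ-* : ∀ a b n → (a * b) ^ n ≡ a ^ n * b ^ n
^-distribʳ-* a b zero    = refl
^-distribʳ-* a b (suc n) = trans (cong (a * b *_) (^-distribʳ-* a b n)) (shuffle a b (a ^ n) (b ^ n))
  where
  shuffle : ∀ a b x y → a * b * (x * y) ≡ a * x * (b * y)
  shuffle = solve-∀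

5^c<4^c*n^[2n] : ∀ c n {T B} → 0 < n → B < T * n ^ 2 →
                 5 ^ c * T ^ n ≤ 4 ^ c * B ^ n → 5 ^ c < 4 ^ c * n ^ (2 * n)
5^c<4^c*n^[2n] c n {T} {B} 0<n B<Tn² bound = *-cancelʳ-< (T ^ n) (5 ^ c) (4 ^ c * n ^ (2 * n)) (begin-strict
  5 ^ c * T ^ n                 ≤⟨ bound ⟩
  4 ^ c * B ^ n                 <⟨ *-monoʳ-< (4 ^ c) {{m^n≢0 4 c}} (^-monoˡ-< n {{>-nonZero 0<n}} B<Tn²) ⟩
  4 ^ c * (T * n ^ 2) ^ n       ≡⟨ cong (4 ^ c *_) (^-distribʳ-* T (n ^ 2) n) ⟩
  4 ^ c * (T ^ n * (n ^ 2) ^ n) ≡⟨ cong (λ x → 4 ^ c * (T ^ n * x)) (^-*-assoc n 2 n) ⟩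
  4 ^ c * (T ^ n * n ^ (2 * n)) ≡⟨ shuffle (4 ^ c) (T ^ n) (n ^ (2 * n)) ⟩
  4 ^ c * n ^ (2 * n) * T ^ n   ∎)
  where
  open ≤-Reasoning
  shuffle : ∀ a b d → a * (b * d) ≡ a * d * b
  shuffle = solve-∀

5^6<4^6*n² : ∀ {n} → 2 ≤ n → 5 ^ 6 < 4 ^ 6 * n ^ 2
5^6<4^6*n² 2≤n = ≤-trans (≤ᵇ⇒≤ (suc (5 ^ 6)) (4 ^ 6 * 2 ^ 2) _) (*-monoʳ-≤ (4 ^ 6) (^-monoˡ-≤ 2 2≤n))

[n∸4]²<n² : ∀ {n} → 13 ≤ n → (n ∸ 4) * (n ∸ 4) < 1 * n ^ 2
[n∸4]²<n² {n} 13≤n =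
  subst ((n ∸ 4) * (n ∸ 4) <_) (sym (trans (*-identityˡ _) (cong (n *_) (*-identityʳ n)))) (*-mono-< n∸4<n n∸4<n)
  where
  n∸4<n : n ∸ 4 < n
  n∸4<n = ∸-monoʳ-< {n} {4} {0} z<s (≤-trans (≤ᵇ⇒≤ 4 13 _) 13≤n)

theorem3p4 : {A : Set} (Q : List A) → 2 ≤ length Q → SquareFree Q →
    (ps : List (ℕ × ℕ)) → Unique ps → All (AlmostSquareOcc Q) ps →
    5 ^ length ps < 4 ^ length ps * length Q ^ (2 * length Q)
theorem3p4 Q 2≤n sf ps distinct occ with length Q ≤? 12
... | yes n≤12 = 5^c<4^c*n^[2n] (length ps) (length Q) (≤-trans z<s 2≤n) (5^6<4^6*n² 2≤n)
      (positions-bound (position-bound-small Q sf n≤12) (length Q) ps distinct occ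
        (All.map (occurrence-position Q) occ))
... | no  n≰12 = 5^c<4^c*n^[2n] (length ps) (length Q) (≤-trans z<s 2≤n) ([n∸4]²<n² (≰⇒> n≰12))
      (positions-bound (position-bound-large Q sf (≰⇒> n≰12)) (length Q) ps distinct occ
        (All.map (occurrence-position Q) occ))
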